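{- Let $G=(A,B,E)$ be a balanced bipartite graph with $2n$ vertices ($n\geq 1$) and let $X$ be its reduced adjacency matrix. Then $G$ is $\alpha^+$-stable if and only if there exist permutation matrices $P,Q$ of order $n$ and an integer $k\geq 1$ such that $$PXQ=\begin{bmatrix} X_1 & X_{12} & X_{13} & \cdots & X_{1k}\\ O & X_2 & X_{23} & \cdots & X_{2k}\\ \vdots & & \ddots & & \vdots\\ O & O & \cdots & O & X_k\end{bmatrix},$$ where $X_1,\dots,X_k$ are square fully indecomposable matrices, the blocks $O$ below the diagonal are zero matrices, and the blocks $X_{ij}$ ($i<j$) are arbitrary $(0,1)$-matrices.
   Context: All graphs are finite and simple. For a graph $G$, $\alpha(G)$ is the largest cardinality of a stable set. $G$ is $\alpha^+$-stable if $\alpha(G+e)=\alpha(G)$ for every pair $e=xy$ of distinct nonadjacent vertices $x,y$. A bipartite graph $G=(A,B,E)$ is balanced if $|A|=|B|$. With $A=\{a_1,\dots,a_n\}$, $B=\{b_1,\dots,b_n\}$, the reduced adjacency matrix is $X=[x_{ij}]$ with $x_{ij}=1$ iff $a_ib_j\in E$, else $0$. A square $(0,1)$-matrix of order $r$ is partly decomposable if either $r=1$ and its entry is $0$, or $r>1$ and it has a $k\times(r-k)$ zero submatrix for some $1\leq k\leq r-1$; otherwise it is fully indecomposable. -}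

module Defs where

open import Data.Nat using (ℕ; zero; suc; _+_; _∸_; _≤_; _<_)
open import Data.Bool using (Bool; true; false; _∨_; _∧_)
open import Data.Fin using (Fin; zero; suc; splitAt; _↑ˡ_; _↑ʳ_)
open import Data.Fin.Properties using (_≟_)
open import Data.Fin.Subset using (Subset; _∈_; ∣_∣)
open import Data.Fin.Permutation using (Permutation′; _⟨$⟩ʳ_)
open import Data.Sum using (_⊎_; inj₁; inj₂)
open import Data.Product using (Σ; ∃; ∃-syntax; _×_)
open import Data.Empty using (⊥)
open import Relation.Nullary using (¬_)
open import Relation.Nullary.Decidable using (⌊_⌋)
open import Relation.Binary.PropositionalEquality using (_≡_; _≢_)

Graph : ℕ → Set
Graph m = Fin m → Fin m → Bool

Stable : ∀ {m} → Graph m → Subset m → Set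
Stable {m} G S = ∀ (u v : Fin m) → u ∈ S → v ∈ S → G u v ≡ false

IsAlpha : ∀ {m} → Graph m → ℕ → Set
IsAlpha {m} G a =
  (Σ (Subset m) λ S → Stable G S × ∣ S ∣ ≡ a) ×
  (∀ (S : Subset m) → Stable G S → ∣ S ∣ ≤ a)

addEdge : ∀ {m} → Graph m → Fin m → Fin m → Graph m
addEdge G x y u v =
  G u v ∨ ((⌊ u ≟ x ⌋ ∧ ⌊ v ≟ y ⌋) ∨ (⌊ u ≟ y ⌋ ∧ ⌊ v ≟ x ⌋))

AlphaPlusStable : ∀ {m} → Graph m → Set
AlphaPlusStable {m} G =
  ∀ (x y : Fin m) → x ≢ y → G x y ≡ false →
  ∀ (a : ℕ) → IsAlpha G a → IsAlpha (addEdge G x y) a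

Matrix : ℕ → ℕ → Set
Matrix r s = Fin r → Fin s → Bool

-- Vertex set Fin (n + n): a_i = i ↑ˡ n  (A),  b_j = n ↑ʳ j  (B);
-- a_i b_j ∈ E iff X i j ≡ true; no edges inside A or inside B.
bipartiteGraph : ∀ n → Matrix n n → Graph (n + n)
bipartiteGraph n X u v with splitAt n u | splitAt n v
... | inj₁ i | inj₂ j = X i j
... | inj₂ j | inj₁ i = X i j
... | inj₁ _ | inj₁ _ = false
... | inj₂ _ | inj₂ _ = false

PartlyDecomposable : ∀ {r} → Matrix r r → Set
PartlyDecomposable {zero} X = ⊥
PartlyDecomposable {suc zero} X = X zero zero ≡ false
PartlyDecomposable {suc (suc r')} X =
  Σ ℕ λ k → 1 ≤ k × k ≤ r ∸ 1 ×
  Σ (Subset r) λ R → Σ (Subset r) λ C →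
    ∣ R ∣ ≡ k × ∣ C ∣ ≡ r ∸ k ×
    (∀ (i j : Fin r) → i ∈ R → j ∈ C → X i j ≡ false)
  where r = suc (suc r')

FullyIndecomposable : ∀ {r} → Matrix r r → Set
FullyIndecomposable {r} X = 1 ≤ r × ¬ PartlyDecomposable X

-- BlockTriangular n Y k : Y is of the block upper triangular form
--   [ X_1 X_12 ... X_1k ; O X_2 ... X_2k ; ... ; O ... O X_k ]
-- with k square fully indecomposable diagonal blocks X_1,...,X_k,
-- zero blocks below the diagonal and arbitrary blocks above.
-- (Described recursively: Y = [ X_1  * ; O  Y' ] with Y' of the same form
-- with k - 1 diagonal blocks.)
data BlockTriangular : (n : ℕ) → Matrix n n → ℕ → Set where
  single : ∀ {r} (Y : Matrix r r) →
    FullyIndecomposable Y → BlockTriangular r Y 1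
  cons : ∀ {r m k} (Y : Matrix (r + m) (r + m)) →
    FullyIndecomposable (λ i j → Y (i ↑ˡ m) (j ↑ˡ m)) →
    (∀ (i : Fin m) (j : Fin r) → Y (r ↑ʳ i) (j ↑ˡ m) ≡ false) →
    BlockTriangular m (λ i j → Y (r ↑ʳ i) (r ↑ʳ j)) k →
    BlockTriangular (r + m) Y (suc k)

-- P X Q for permutation matrices P, Q: rows permuted by σ, columns by τ.
permute : ∀ {n} → Permutation′ n → Permutation′ n → Matrix n n → Matrix n n
permute σ τ X i j = X (σ ⟨$⟩ʳ i) (τ ⟨$⟩ʳ j)

module Submission where

-- Stable sets of G are the sets R ++ C with X vanishing on R × C, so α(G) is the largest value
-- ν of |R| + |C| over such zero blocks. If ν = n, the sides A and B are disjoint maximum stable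
-- sets and every pair x, y misses one of them, so adding xy keeps α. If ν > n, inclusion–exclusion
-- shows that maximum zero blocks are closed under (R, C) ↦ (R ∩ R′, C ∪ C′), so one with fewest
-- rows has a row i lying in every maximum zero block; dually some column j lies in every one, so
-- the nonadjacent vertices a_i, b_j lie in every maximum stable set and adding a_i b_j lowers α.
-- Hence α⁺-stability means that no zero block has |R| + |C| > n. These are exactly the matrices
-- permutable into the block triangular form: a k × (n − k) zero block lets one permute X into
-- [X₁ * ; O X₂] with X₁, X₂ again free of large zero blocks, and the recursion stops at fully
-- indecomposable blocks; conversely a zero block of a block triangular matrix restricts to zero
-- blocks of its diagonal blocks.

open import Defs
open import Data.Bool using (Bool; true; false; _∨_; if_then_else_)
open import Data.Bool.Properties using (∧-zeroʳ; ∨-zeroʳ) renaming (_≟_ to _≟ᵇ_)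
open import Data.Empty using (⊥-elim)
open import Data.Fin using (Fin; zero; suc; _↑ˡ_; _↑ʳ_; splitAt; cast)
open import Data.Fin.Properties
  using (_≟_; all?; suc-injective; +↔⊎; join-splitAt; splitAt-↑ˡ; splitAt-↑ʳ; cast-is-id)
open import Data.Fin.Permutation
  using (Permutation; Permutation′; _⟨$⟩ʳ_; id; flip; lift₀; transpose; _∘ₚ_; inverseʳ; ↔⇒≡)
open import Data.Fin.Subset
  using (Subset; inside; outside; _∈_; _∉_; _⊆_; ∣_∣; ∁; ⊤; ⊥; _∩_; _∪_; _-_; Nonempty)
open import Data.Fin.Subset.Properties
  using ( ⊆-min; s⊆s; ∣⊥∣≡0; ∣⊤∣≡n; ∣∁p∣≡n∸∣p∣; x∉∁p⇒x∈p; ∣p∣≤n; ∉⊥; _∈?_; anySubset?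
        ; x∈p∪q⁻; x∈p∩q⁻; p⊆q⇒∣p∣≤∣q∣; x∈p∧x≢y⇒x∈p-y; x∈p⇒∣p-x∣<∣p∣)
open import Data.Nat using (ℕ; zero; suc; _+_; _∸_; _≤_; _<_; _≤?_; z≤n; s≤s; s≤s⁻¹)
  renaming (_≟_ to _≟ℕ_)
open import Data.Nat.Induction using (<-wellFounded)
open import Data.Nat.Properties
  using ( +-0-commutativeMonoid; +-commutativeSemigroup; +-suc; +-comm; +-assoc; +-identityʳ
        ; +-mono-≤; +-monoʳ-≤; +-cancelʳ-≤; +-cancelˡ-≤; ≤-refl; ≤-antisym; ≤-<-trans; <-≤-trans
        ; <⇒≤; <⇒≱; ≰⇒>; <-irrefl; n≤0⇒n≡0; ≤∧≢⇒<; m≤n⇒m≤1+n; m≤n+o⇒m∸n≤o; ∸-monoˡ-≤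
        ; m∸[m∸n]≡n; m+[n∸m]≡n; m<n⇒0<n∸m; m+n∸m≡n; m+n∸n≡m; m<n+m; m<m+n
        ; module ≤-Reasoning)
open import Algebra.Properties.CommutativeSemigroup +-commutativeSemigroup using (interchange)
open import Algebra.Properties.CommutativeMonoid.Sum +-0-commutativeMonoid using (sum; sum-permute)
open import Data.Product using (Σ; ∃; ∃₂; ∃-syntax; _×_; _,_; proj₁; proj₂)
open import Data.Sum using (inj₁; inj₂)
open import Data.Sum.Function.Propositional using (_⊎-↔_)
open import Data.Vec using ([]; _∷_; _++_; here; there; lookup; tabulate)
import Data.Vec as Vec
open import Data.Vec.Properties using (tabulate∘lookup; lookup∘tabulate; []=⇒lookup; lookup⇒[]=)
open import Function.Bundles using (_⇔_; mk⇔)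
open import Function.Properties.Inverse using (↔-trans; ↔-sym)
open import Induction.WellFounded using (Acc; acc)
open import Relation.Binary.PropositionalEquality
  using (_≡_; _≢_; refl; sym; trans; cong; cong₂; subst; module ≡-Reasoning)
open import Relation.Nullary using (¬_; Dec; yes; no)
open import Relation.Nullary.Decidable using (⌊_⌋; _×-dec_; _→-dec_; decidable-stable)
open import Relation.Unary using (Decidable)

least : {P : ℕ → Set} → Decidable P → ∀ {t} → P t → ∃[ j ] P j × (∀ {k} → P k → j ≤ k)
least P? p with P? 0
... | yes p₀ = 0 , p₀ , λ _ → z≤n
least P? {zero} p | no ¬p₀ = ⊥-elim (¬p₀ p)
least {P} P? {suc t} p | no ¬p₀ with least (λ k → P? (suc k)) p
... | j , pj , minimal = suc j , pj , λ { {zero} p₀ → ⊥-elim (¬p₀ p₀) ; {suc k} pk → s≤s (minimal pk) }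

greatest : {P : ℕ → Set} → Decidable P → ∀ t → (∀ {k} → P k → k ≤ t) →
           ∀ {s} → P s → ∃[ j ] P j × (∀ {k} → P k → k ≤ j)
greatest P? t bounded ps with P? t
... | yes pt = t , pt , bounded
greatest {P} P? zero bounded ps | no ¬pt = ⊥-elim (¬pt (subst P (n≤0⇒n≡0 (bounded ps)) ps))
greatest {P} P? (suc t) bounded ps | no ¬pt =
  greatest P? t (λ pk → s≤s⁻¹ (≤∧≢⇒< (bounded pk) λ k≡t → ¬pt (subst P k≡t pk))) ps

+-suc-cong : ∀ {a b c d} → a + b ≡ c + d → a + suc b ≡ c + suc d
+-suc-cong {a} {b} {c} {d} eq = trans (+-suc a b) (trans (cong suc eq) (sym (+-suc c d)))

n<m+o∧o≤n⇒1≤m : ∀ {m n o} → o ≤ n → n < m + o → 1 ≤ m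
n<m+o∧o≤n⇒1≤m {zero} o≤n n<o = ⊥-elim (<⇒≱ n<o o≤n)
n<m+o∧o≤n⇒1≤m {suc m} _ _ = s≤s z≤n

n<m+o∧m≤n⇒1≤o : ∀ {m n o} → m ≤ n → n < m + o → 1 ≤ o
n<m+o∧m≤n⇒1≤o {m} {n} {o} m≤n n<m+o = n<m+o∧o≤n⇒1≤m m≤n (subst (n <_) (+-comm m o) n<m+o)

splitSize : ∀ {n a c} → 2 ≤ n → a ≤ n → c ≤ n → n < a + c →
            ∃[ k ] 1 ≤ k × k ≤ n ∸ 1 × k ≤ a × n ∸ k ≤ c
splitSize {n} {a} {c} 2≤n a≤n c≤n n<a+c with a ≤? n ∸ 1
... | yes a≤n∸1 = a , n<m+o∧o≤n⇒1≤m c≤n n<a+c , a≤n∸1 , ≤-refl , m≤n+o⇒m∸n≤o n a (<⇒≤ n<a+c)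
... | no a≰n∸1 = n ∸ 1 , ∸-monoˡ-≤ 1 2≤n , ≤-refl , <⇒≤ (≰⇒> a≰n∸1) ,
                 subst (_≤ c) (sym (m∸[m∸n]≡n (<⇒≤ 2≤n))) (n<m+o∧m≤n⇒1≤o a≤n n<a+c)

↑-elim : ∀ {r m} {P : Fin (r + m) → Set} → (∀ i → P (i ↑ˡ m)) → (∀ j → P (r ↑ʳ j)) → ∀ x → P x
↑-elim {r} {m} {P} left right x with splitAt r x | join-splitAt r m x
... | inj₁ i | i↑ˡm≡x = subst P i↑ˡm≡x (left i)
... | inj₂ j | r↑ʳj≡x = subst P r↑ʳj≡x (right j)

↑ˡ≢↑ʳ : ∀ {m n} (i : Fin m) (j : Fin n) → i ↑ˡ n ≢ m ↑ʳ j
↑ˡ≢↑ʳ zero j ()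
↑ˡ≢↑ʳ (suc i) j eq = ↑ˡ≢↑ʳ i j (suc-injective eq)

reassoc : ∀ r s m → Fin (r + (s + m)) → Fin ((r + s) + m)
reassoc r s m = cast (sym (+-assoc r s m))

reassoc-↑ˡ : ∀ {r s m} (i : Fin r) → reassoc r s m (i ↑ˡ (s + m)) ≡ (i ↑ˡ s) ↑ˡ m
reassoc-↑ˡ zero = refl
reassoc-↑ˡ (suc i) = cong suc (reassoc-↑ˡ i)

reassoc-↑ʳ-↑ˡ : ∀ r {s m} (i : Fin s) → reassoc r s m (r ↑ʳ (i ↑ˡ m)) ≡ (r ↑ʳ i) ↑ˡ m
reassoc-↑ʳ-↑ˡ zero {s} {m} i = cast-is-id refl (i ↑ˡ m)
reassoc-↑ʳ-↑ˡ (suc r) i = cong suc (reassoc-↑ʳ-↑ˡ r i)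

reassoc-↑ʳ-↑ʳ : ∀ r {s m} (i : Fin m) → reassoc r s m (r ↑ʳ (s ↑ʳ i)) ≡ (r + s) ↑ʳ i
reassoc-↑ʳ-↑ʳ zero {s} i = cast-is-id refl (s ↑ʳ i)
reassoc-↑ʳ-↑ʳ (suc r) i = cong suc (reassoc-↑ʳ-↑ʳ r i)

∈-++⁺ˡ : ∀ {a b} {p : Subset a} {q : Subset b} {i} → i ∈ p → i ↑ˡ b ∈ p ++ q
∈-++⁺ˡ here = here
∈-++⁺ˡ (there i∈p) = there (∈-++⁺ˡ i∈p)

∈-++⁺ʳ : ∀ {a b} (p : Subset a) {q : Subset b} {j} → j ∈ q → a ↑ʳ j ∈ p ++ q
∈-++⁺ʳ [] j∈q = j∈q
∈-++⁺ʳ (_ ∷ p) j∈q = there (∈-++⁺ʳ p j∈q)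

∈-++⁻ˡ : ∀ {a b} (p : Subset a) {q : Subset b} i → i ↑ˡ b ∈ p ++ q → i ∈ p
∈-++⁻ˡ (_ ∷ _) zero here = here
∈-++⁻ˡ (_ ∷ p) (suc i) (there i∈p++q) = there (∈-++⁻ˡ p i i∈p++q)

∈-++⁻ʳ : ∀ {a b} (p : Subset a) {q : Subset b} {j} → a ↑ʳ j ∈ p ++ q → j ∈ q
∈-++⁻ʳ [] j∈q = j∈q
∈-++⁻ʳ (_ ∷ p) (there j∈p++q) = ∈-++⁻ʳ p j∈p++q

∣p++q∣≡∣p∣+∣q∣ : ∀ {a b} (p : Subset a) (q : Subset b) → ∣ p ++ q ∣ ≡ ∣ p ∣ + ∣ q ∣
∣p++q∣≡∣p∣+∣q∣ [] q = refl
∣p++q∣≡∣p∣+∣q∣ (inside ∷ p) q = cong suc (∣p++q∣≡∣p∣+∣q∣ p q)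
∣p++q∣≡∣p∣+∣q∣ (outside ∷ p) q = ∣p++q∣≡∣p∣+∣q∣ p q

∣p∩q∣+∣p∪q∣≡∣p∣+∣q∣ : ∀ {n} (p q : Subset n) → ∣ p ∩ q ∣ + ∣ p ∪ q ∣ ≡ ∣ p ∣ + ∣ q ∣
∣p∩q∣+∣p∪q∣≡∣p∣+∣q∣ [] [] = refl
∣p∩q∣+∣p∪q∣≡∣p∣+∣q∣ (inside ∷ p) (inside ∷ q) = cong suc (+-suc-cong (∣p∩q∣+∣p∪q∣≡∣p∣+∣q∣ p q))
∣p∩q∣+∣p∪q∣≡∣p∣+∣q∣ (inside ∷ p) (outside ∷ q) =
  trans (+-suc ∣ p ∩ q ∣ ∣ p ∪ q ∣) (cong suc (∣p∩q∣+∣p∪q∣≡∣p∣+∣q∣ p q))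
∣p∩q∣+∣p∪q∣≡∣p∣+∣q∣ (outside ∷ p) (inside ∷ q) = +-suc-cong (∣p∩q∣+∣p∪q∣≡∣p∣+∣q∣ p q)
∣p∩q∣+∣p∪q∣≡∣p∣+∣q∣ (outside ∷ p) (outside ∷ q) = ∣p∩q∣+∣p∪q∣≡∣p∣+∣q∣ p q

⊆-ofSize : ∀ {n} (p : Subset n) {t} → t ≤ ∣ p ∣ → ∃[ q ] q ⊆ p × ∣ q ∣ ≡ t
⊆-ofSize [] z≤n = [] , (λ ()) , refl
⊆-ofSize {suc n} p {zero} _ = ⊥ , ⊆-min p , ∣⊥∣≡0 (suc n)
⊆-ofSize (inside ∷ p) {suc t} (s≤s t≤∣p∣) with ⊆-ofSize p t≤∣p∣
... | q , q⊆p , ∣q∣≡t = inside ∷ q , s⊆s q⊆p , cong suc ∣q∣≡t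
⊆-ofSize (outside ∷ p) {suc t} t≤∣p∣ with ⊆-ofSize p t≤∣p∣
... | q , q⊆p , ∣q∣≡t = outside ∷ q , s⊆s q⊆p , ∣q∣≡t

1≤∣p∣⇒nonempty : ∀ {n} (p : Subset n) → 1 ≤ ∣ p ∣ → Nonempty p
1≤∣p∣⇒nonempty (inside ∷ p) _ = zero , here
1≤∣p∣⇒nonempty (outside ∷ p) 1≤∣p∣ with 1≤∣p∣⇒nonempty p 1≤∣p∣
... | i , i∈p = suc i , there i∈p

preimage : ∀ {m n} → (Fin m → Fin n) → Subset n → Subset m
preimage f p = tabulate (λ i → lookup p (f i))

∈-preimage⁻ : ∀ {m n} {f : Fin m → Fin n} {p : Subset n} {i} → i ∈ preimage f p → f i ∈ p
∈-preimage⁻ {f = f} {p} {i} i∈ =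
  lookup⇒[]= (f i) p (trans (sym (lookup∘tabulate _ i)) ([]=⇒lookup i∈))

∣tabulate∣ : ∀ {n} (f : Fin n → Bool) → ∣ tabulate f ∣ ≡ sum (λ i → if f i then 1 else 0)
∣tabulate∣ {zero} f = refl
∣tabulate∣ {suc n} f with f zero
... | true = cong suc (∣tabulate∣ (λ i → f (suc i)))
... | false = ∣tabulate∣ (λ i → f (suc i))

∣preimage∣ : ∀ {m n} (σ : Permutation m n) (p : Subset n) → ∣ preimage (σ ⟨$⟩ʳ_) p ∣ ≡ ∣ p ∣
∣preimage∣ σ p = begin
  ∣ preimage (σ ⟨$⟩ʳ_) p ∣          ≡⟨ ∣tabulate∣ (λ i → lookup p (σ ⟨$⟩ʳ i)) ⟩
  sum (λ i → indicator (σ ⟨$⟩ʳ i))  ≡⟨ sum-permute indicator σ ⟨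
  sum indicator                     ≡⟨ ∣tabulate∣ (lookup p) ⟨
  ∣ tabulate (lookup p) ∣           ≡⟨ cong ∣_∣ (tabulate∘lookup p) ⟩
  ∣ p ∣                             ∎
  where
  open ≡-Reasoning
  indicator : Fin _ → ℕ
  indicator j = if lookup p j then 1 else 0

_⊕_ : ∀ {r m} → Permutation′ r → Permutation′ m → Permutation′ (r + m)
σ ⊕ τ = ↔-trans +↔⊎ (↔-trans (σ ⊎-↔ τ) (↔-sym +↔⊎))

⊕-↑ˡ : ∀ {r m} (σ : Permutation′ r) (τ : Permutation′ m) i → (σ ⊕ τ) ⟨$⟩ʳ (i ↑ˡ m) ≡ (σ ⟨$⟩ʳ i) ↑ˡ m
⊕-↑ˡ {r} {m} σ τ i rewrite splitAt-↑ˡ r i m = refl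

⊕-↑ʳ : ∀ {r m} (σ : Permutation′ r) (τ : Permutation′ m) j → (σ ⊕ τ) ⟨$⟩ʳ (r ↑ʳ j) ≡ r ↑ʳ (τ ⟨$⟩ʳ j)
⊕-↑ʳ {r} {m} σ τ j rewrite splitAt-↑ʳ r m j = refl

moveToFront : ∀ a b → Permutation (a + suc b) (suc (a + b))
moveToFront zero b = id
moveToFront (suc a) b = lift₀ (moveToFront a b) ∘ₚ transpose zero (suc zero)

moveToFront-↑ˡ : ∀ a b (i : Fin a) → moveToFront a b ⟨$⟩ʳ (i ↑ˡ suc b) ≡ suc (i ↑ˡ b)
moveToFront-↑ˡ (suc a) b zero = refl
moveToFront-↑ˡ (suc a) b (suc i) rewrite moveToFront-↑ˡ a b i = refl

moveToFront-↑ʳ-zero : ∀ a b → moveToFront a b ⟨$⟩ʳ (a ↑ʳ zero) ≡ zero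
moveToFront-↑ʳ-zero zero b = refl
moveToFront-↑ʳ-zero (suc a) b rewrite moveToFront-↑ʳ-zero a b = refl

moveToFront-↑ʳ-suc : ∀ a b (j : Fin b) → moveToFront a b ⟨$⟩ʳ (a ↑ʳ suc j) ≡ suc (a ↑ʳ j)
moveToFront-↑ʳ-suc zero b j = refl
moveToFront-↑ʳ-suc (suc a) b j rewrite moveToFront-↑ʳ-suc a b j = refl

Sorts : ∀ a b {n} → Subset n → Permutation (a + b) n → Set
Sorts a b S ρ = (∀ i → ρ ⟨$⟩ʳ (i ↑ˡ b) ∈ S) × (∀ j → ρ ⟨$⟩ʳ (a ↑ʳ j) ∉ S)

sortingPermutation : ∀ {n} (S : Subset n) → Σ (Permutation (∣ S ∣ + ∣ ∁ S ∣) n) (Sorts ∣ S ∣ ∣ ∁ S ∣ S)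
sortingPermutation [] = id , (λ ()) , (λ ())
sortingPermutation (inside ∷ S) with sortingPermutation S
... | ρ , ρ-∈ , ρ-∉ = lift₀ ρ , first , λ j → λ { (there ∈S) → ρ-∉ j ∈S }
  where
  first : ∀ i → lift₀ ρ ⟨$⟩ʳ (i ↑ˡ _) ∈ inside ∷ S
  first zero = here
  first (suc i) = there (ρ-∈ i)
sortingPermutation (outside ∷ S) with sortingPermutation S
... | ρ , ρ-∈ , ρ-∉ = μ ∘ₚ lift₀ ρ , first , second
  where
  μ : Permutation (∣ S ∣ + suc ∣ ∁ S ∣) (suc (∣ S ∣ + ∣ ∁ S ∣))
  μ = moveToFront ∣ S ∣ ∣ ∁ S ∣
  first : ∀ i → lift₀ ρ ⟨$⟩ʳ (μ ⟨$⟩ʳ (i ↑ˡ _)) ∈ outside ∷ S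
  first i rewrite moveToFront-↑ˡ ∣ S ∣ ∣ ∁ S ∣ i = there (ρ-∈ i)
  second : ∀ j → lift₀ ρ ⟨$⟩ʳ (μ ⟨$⟩ʳ (∣ S ∣ ↑ʳ j)) ∉ outside ∷ S
  second zero rewrite moveToFront-↑ʳ-zero ∣ S ∣ ∣ ∁ S ∣ = λ ()
  second (suc j) rewrite moveToFront-↑ʳ-suc ∣ S ∣ ∣ ∁ S ∣ j = λ { (there ∈S) → ρ-∉ j ∈S }

sortingPermutation′ : ∀ {n a b} (S : Subset n) → ∣ S ∣ ≡ a → ∣ ∁ S ∣ ≡ b →
                      Σ (Permutation (a + b) n) (Sorts a b S)
sortingPermutation′ S refl refl = sortingPermutation S

-- α⁺-stability in an arbitrary graph

∨≡false⇒ˡ : ∀ {a b} → a ∨ b ≡ false → a ≡ false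
∨≡false⇒ˡ {false} _ = refl

addEdge-stable⁻ : ∀ {m} {G : Graph m} {x y S} → Stable (addEdge G x y) S → Stable G S
addEdge-stable⁻ st u v u∈S v∈S = ∨≡false⇒ˡ (st u v u∈S v∈S)

addEdge-stable⁺ : ∀ {m} {G : Graph m} {x y T} → Stable G T → x ∉ T → Stable (addEdge G x y) T
addEdge-stable⁺ {x = x} {y} st x∉T u v u∈T v∈T rewrite st u v u∈T v∈T with u ≟ x | v ≟ x
... | yes refl | _ = ⊥-elim (x∉T u∈T)
... | _ | yes refl = ⊥-elim (x∉T v∈T)
... | no _ | no _ = ∧-zeroʳ ⌊ u ≟ y ⌋

addEdge-joins : ∀ {m} (G : Graph m) x y → addEdge G x y x y ≡ true
addEdge-joins G x y with x ≟ x | y ≟ y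
... | yes _ | yes _ = ∨-zeroʳ (G x y)
... | no x≢x | _ = ⊥-elim (x≢x refl)
... | yes _ | no y≢y = ⊥-elim (y≢y refl)

maximumStableSet-size : ∀ {m} {G : Graph m} {a S} → IsAlpha G a → Stable G S →
  (∀ U → Stable G U → ∣ U ∣ ≤ ∣ S ∣) → ∣ S ∣ ≡ a
maximumStableSet-size ((U , stU , ∣U∣≡a) , ≤a) stS maximal =
  ≤-antisym (≤a _ stS) (subst (_≤ _) ∣U∣≡a (maximal U stU))

isAlpha-addEdge : ∀ {m} {G : Graph m} {a x y W} → IsAlpha G a → Stable G W → x ∉ W → ∣ W ∣ ≡ a →
  IsAlpha (addEdge G x y) a
isAlpha-addEdge {W = W} (_ , ≤a) stW x∉W ∣W∣≡a =
  (W , addEdge-stable⁺ stW x∉W , ∣W∣≡a) , λ V st → ≤a V (addEdge-stable⁻ st)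

disjointMaximumStableSets⇒alphaPlusStable : ∀ {m} {G : Graph m} {S T} → Stable G S → Stable G T →
  (∀ {u} → u ∈ S → u ∉ T) → ∣ T ∣ ≡ ∣ S ∣ → (∀ U → Stable G U → ∣ U ∣ ≤ ∣ S ∣) → AlphaPlusStable G
disjointMaximumStableSets⇒alphaPlusStable {S = S} stS stT disjoint ∣T∣≡∣S∣ maximal x y _ _ a isα
  with x ∈? S
... | yes x∈S = isAlpha-addEdge isα stT (disjoint x∈S) (trans ∣T∣≡∣S∣ (maximumStableSet-size isα stS maximal))
... | no x∉S = isAlpha-addEdge isα stS x∉S (maximumStableSet-size isα stS maximal)

commonVertices⇒¬alphaPlusStable : ∀ {m} {G : Graph m} {α x y} → IsAlpha G α → x ≢ y →
  (∀ S → Stable G S → ∣ S ∣ ≡ α → x ∈ S × y ∈ S) → ¬ AlphaPlusStable G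
commonVertices⇒¬alphaPlusStable {G = G} {α} {x} {y} isα@((S , stS , ∣S∣≡α) , _) x≢y common aps
  with common S stS ∣S∣≡α
... | x∈S , y∈S with aps x y x≢y (stS x y x∈S y∈S) α isα
... | (S′ , stS′ , ∣S′∣≡α) , _ with common S′ (addEdge-stable⁻ stS′) ∣S′∣≡α
... | x∈S′ , y∈S′ with trans (sym (addEdge-joins G x y)) (stS′ x y x∈S′ y∈S′)
... | ()

-- Zero blocks

ZeroBlock : ∀ {r s} → Matrix r s → Subset r → Subset s → Set
ZeroBlock {r} {s} X R C = ∀ (i : Fin r) (j : Fin s) → i ∈ R → j ∈ C → X i j ≡ false

ZeroBlocksAtMost : ∀ {r s} → Matrix r s → ℕ → Set
ZeroBlocksAtMost X a = ∀ R C → ZeroBlock X R C → ∣ R ∣ + ∣ C ∣ ≤ a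

IsMaxZeroBlockSize : ∀ {r s} → Matrix r s → ℕ → Set
IsMaxZeroBlockSize X α = (∃[ R ] ∃[ C ] ZeroBlock X R C × ∣ R ∣ + ∣ C ∣ ≡ α) × ZeroBlocksAtMost X α

NoLargeZeroBlock : ∀ {n} → Matrix n n → Set
NoLargeZeroBlock {n} X = ZeroBlocksAtMost X n

_ᵀ : ∀ {r s} → Matrix r s → Matrix s r
(X ᵀ) i j = X j i

zeroBlock? : ∀ {r s} (X : Matrix r s) R C → Dec (ZeroBlock X R C)
zeroBlock? X R C = all? λ i → all? λ j → (i ∈? R) →-dec ((j ∈? C) →-dec (X i j ≟ᵇ false))

zeroBlock-ᵀ : ∀ {r s} {X : Matrix r s} {R C} → ZeroBlock X R C → ZeroBlock (X ᵀ) C R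
zeroBlock-ᵀ z j i j∈C i∈R = z i j i∈R j∈C

zeroBlock-⊥ˡ : ∀ {r s} {X : Matrix r s} {C} → ZeroBlock X ⊥ C
zeroBlock-⊥ˡ i j i∈⊥ _ = ⊥-elim (∉⊥ i∈⊥)

zeroBlock-⊥ʳ : ∀ {r s} {X : Matrix r s} {R} → ZeroBlock X R ⊥
zeroBlock-⊥ʳ i j _ j∈⊥ = ⊥-elim (∉⊥ j∈⊥)

zeroBlock-⊆ : ∀ {r s} {X : Matrix r s} {R R′ C C′} →
  ZeroBlock X R C → R′ ⊆ R → C′ ⊆ C → ZeroBlock X R′ C′
zeroBlock-⊆ z R′⊆R C′⊆C i j i∈R′ j∈C′ = z i j (R′⊆R i∈R′) (C′⊆C j∈C′)

zeroBlock-∩-∪ : ∀ {r s} {X : Matrix r s} {R R′ C C′} →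
  ZeroBlock X R C → ZeroBlock X R′ C′ → ZeroBlock X (R ∩ R′) (C ∪ C′)
zeroBlock-∩-∪ {R = R} {R′} {C} {C′} z z′ i j i∈R∩R′ j∈C∪C′ with x∈p∪q⁻ C C′ j∈C∪C′
... | inj₁ j∈C = z i j (proj₁ (x∈p∩q⁻ R R′ i∈R∩R′)) j∈C
... | inj₂ j∈C′ = z′ i j (proj₂ (x∈p∩q⁻ R R′ i∈R∩R′)) j∈C′

zeroBlock-∪-∩ : ∀ {r s} {X : Matrix r s} {R R′ C C′} →
  ZeroBlock X R C → ZeroBlock X R′ C′ → ZeroBlock X (R ∪ R′) (C ∩ C′)
zeroBlock-∪-∩ z z′ = zeroBlock-ᵀ (zeroBlock-∩-∪ (zeroBlock-ᵀ z) (zeroBlock-ᵀ z′))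

zeroBlock-++ : ∀ {r m s t} {Y : Matrix (r + m) (s + t)} {R₁ R₂ C₁ C₂} →
  ZeroBlock (λ i j → Y (i ↑ˡ m) (j ↑ˡ t)) R₁ C₁ → ZeroBlock (λ i j → Y (i ↑ˡ m) (s ↑ʳ j)) R₁ C₂ →
  ZeroBlock (λ i j → Y (r ↑ʳ i) (j ↑ˡ t)) R₂ C₁ → ZeroBlock (λ i j → Y (r ↑ʳ i) (s ↑ʳ j)) R₂ C₂ →
  ZeroBlock Y (R₁ ++ R₂) (C₁ ++ C₂)
zeroBlock-++ {Y = Y} {R₁} {R₂} {C₁} {C₂} z₁₁ z₁₂ z₂₁ z₂₂ =
  ↑-elim {P = λ x → ∀ y → x ∈ R₁ ++ R₂ → y ∈ C₁ ++ C₂ → Y x y ≡ false}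
    (λ i → ↑-elim (λ j i∈ j∈ → z₁₁ i j (∈-++⁻ˡ R₁ i i∈) (∈-++⁻ˡ C₁ j j∈))
                  (λ j i∈ j∈ → z₁₂ i j (∈-++⁻ˡ R₁ i i∈) (∈-++⁻ʳ C₁ j∈)))
    (λ i → ↑-elim (λ j i∈ j∈ → z₂₁ i j (∈-++⁻ʳ R₁ i∈) (∈-++⁻ˡ C₁ j j∈))
                  (λ j i∈ j∈ → z₂₂ i j (∈-++⁻ʳ R₁ i∈) (∈-++⁻ʳ C₁ j∈)))

maxZeroBlockSize : ∀ {r s} (X : Matrix r s) → ∃ (IsMaxZeroBlockSize X)
maxZeroBlockSize {r} {s} X with greatest {P = HasSize} hasSize? (r + s) bounded empty
  where
  HasSize : ℕ → Set
  HasSize k = ∃[ R ] ∃[ C ] ZeroBlock X R C × ∣ R ∣ + ∣ C ∣ ≡ k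
  hasSize? : Decidable HasSize
  hasSize? k = anySubset? λ R → anySubset? λ C → zeroBlock? X R C ×-dec (∣ R ∣ + ∣ C ∣ ≟ℕ k)
  bounded : ∀ {k} → HasSize k → k ≤ r + s
  bounded (R , C , _ , refl) = +-mono-≤ (∣p∣≤n R) (∣p∣≤n C)
  empty : HasSize 0
  empty = ⊥ , ⊥ , zeroBlock-⊥ˡ , cong₂ _+_ (∣⊥∣≡0 r) (∣⊥∣≡0 s)
... | α , hasα , maximal = α , hasα , λ R C z → maximal (R , C , z , refl)

isMaxZeroBlockSize-ᵀ : ∀ {r s α} {X : Matrix r s} → IsMaxZeroBlockSize X α → IsMaxZeroBlockSize (X ᵀ) α
isMaxZeroBlockSize-ᵀ {α = α} ((R , C , z , size) , atMost) =
  (C , R , zeroBlock-ᵀ z , trans (+-comm ∣ C ∣ ∣ R ∣) size) ,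
  λ C′ R′ z′ → subst (_≤ α) (+-comm ∣ R′ ∣ ∣ C′ ∣) (atMost R′ C′ (zeroBlock-ᵀ z′))

maxZeroBlock-∩-∪ : ∀ {r s α} {X : Matrix r s} {R R′ C C′} → ZeroBlocksAtMost X α →
  ZeroBlock X R C → ∣ R ∣ + ∣ C ∣ ≡ α → ZeroBlock X R′ C′ → ∣ R′ ∣ + ∣ C′ ∣ ≡ α →
  ∣ R ∩ R′ ∣ + ∣ C ∪ C′ ∣ ≡ α
maxZeroBlock-∩-∪ {α = α} {R = R} {R′} {C} {C′} atMost z size z′ size′ =
  ≤-antisym meet≤α (+-cancelʳ-≤ α α meet α+α≤meet+α)
  where
  meet join : ℕ
  meet = ∣ R ∩ R′ ∣ + ∣ C ∪ C′ ∣
  join = ∣ R ∪ R′ ∣ + ∣ C ∩ C′ ∣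
  meet≤α : meet ≤ α
  meet≤α = atMost _ _ (zeroBlock-∩-∪ z z′)
  meet+join≡α+α : meet + join ≡ α + α
  meet+join≡α+α = begin
    meet + join                                           ≡⟨ interchange (∣ R ∩ R′ ∣) (∣ C ∪ C′ ∣) _ _ ⟩
    (∣ R ∩ R′ ∣ + ∣ R ∪ R′ ∣) + (∣ C ∪ C′ ∣ + ∣ C ∩ C′ ∣)  ≡⟨ cong₂ _+_ (∣p∩q∣+∣p∪q∣≡∣p∣+∣q∣ R R′)
                                                               (trans (+-comm (∣ C ∪ C′ ∣) _)
                                                                      (∣p∩q∣+∣p∪q∣≡∣p∣+∣q∣ C C′)) ⟩
    (∣ R ∣ + ∣ R′ ∣) + (∣ C ∣ + ∣ C′ ∣)                    ≡⟨ interchange (∣ R ∣) (∣ R′ ∣) (∣ C ∣) _ ⟩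
    (∣ R ∣ + ∣ C ∣) + (∣ R′ ∣ + ∣ C′ ∣)                    ≡⟨ cong₂ _+_ size size′ ⟩
    α + α                                                 ∎
    where open ≡-Reasoning
  α+α≤meet+α : α + α ≤ meet + α
  α+α≤meet+α = subst (_≤ meet + α) meet+join≡α+α (+-monoʳ-≤ meet (atMost _ _ (zeroBlock-∪-∩ z z′)))

coreRow : ∀ {r s α} (X : Matrix r s) → IsMaxZeroBlockSize X α → s < α →
          ∃[ a ] (∀ R C → ZeroBlock X R C → ∣ R ∣ + ∣ C ∣ ≡ α → a ∈ R)
coreRow {r} {s} {α} X ((R₀ , C₀ , z₀ , size₀) , atMost) s<α
  with least {P = HasRowCount} hasRowCount? (R₀ , C₀ , z₀ , size₀ , refl)
  where
  HasRowCount : ℕ → Set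
  HasRowCount k = ∃[ R ] ∃[ C ] ZeroBlock X R C × ∣ R ∣ + ∣ C ∣ ≡ α × ∣ R ∣ ≡ k
  hasRowCount? : Decidable HasRowCount
  hasRowCount? k = anySubset? λ R → anySubset? λ C →
    zeroBlock? X R C ×-dec (∣ R ∣ + ∣ C ∣ ≟ℕ α) ×-dec (∣ R ∣ ≟ℕ k)
... | _ , (R₁ , C₁ , z₁ , size₁ , refl) , fewest
  with 1≤∣p∣⇒nonempty R₁ (n<m+o∧o≤n⇒1≤m (∣p∣≤n C₁) (subst (s <_) (sym size₁) s<α))
... | a , a∈R₁ = a , a∈
  where
  a∈ : ∀ R C → ZeroBlock X R C → ∣ R ∣ + ∣ C ∣ ≡ α → a ∈ R
  a∈ R C z size with a ∈? R
  ... | yes a∈R = a∈R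
  ... | no a∉R = ⊥-elim (<⇒≱ fewer (fewest (R ∩ R₁ , C ∪ C₁ , zeroBlock-∩-∪ z z₁ ,
                                             maxZeroBlock-∩-∪ atMost z size z₁ size₁ , refl)))
    where
    R∩R₁⊆R₁-a : R ∩ R₁ ⊆ R₁ - a
    R∩R₁⊆R₁-a x∈R∩R₁ with x∈p∩q⁻ R R₁ x∈R∩R₁
    ... | x∈R , x∈R₁ = x∈p∧x≢y⇒x∈p-y x∈R₁ λ { refl → a∉R x∈R }
    fewer : ∣ R ∩ R₁ ∣ < ∣ R₁ ∣
    fewer = ≤-<-trans (p⊆q⇒∣p∣≤∣q∣ R∩R₁⊆R₁-a) (x∈p⇒∣p-x∣<∣p∣ a∈R₁)

coreColumn : ∀ {r s α} (X : Matrix r s) → IsMaxZeroBlockSize X α → r < α →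
             ∃[ b ] (∀ R C → ZeroBlock X R C → ∣ R ∣ + ∣ C ∣ ≡ α → b ∈ C)
coreColumn X isMax r<α with coreRow (X ᵀ) (isMaxZeroBlockSize-ᵀ isMax) r<α
... | b , b∈ = b , λ R C z size → b∈ C R (zeroBlock-ᵀ z) (trans (+-comm ∣ C ∣ ∣ R ∣) size)

noLargeZeroBlock-unpermute : ∀ {a n} {X : Matrix n n} (σ τ : Permutation a n) →
  NoLargeZeroBlock (λ i j → X (σ ⟨$⟩ʳ i) (τ ⟨$⟩ʳ j)) → NoLargeZeroBlock X
noLargeZeroBlock-unpermute {a} {n} σ τ nz R C z = begin
  ∣ R ∣ + ∣ C ∣                                      ≡⟨ cong₂ _+_ (∣preimage∣ σ R) (∣preimage∣ τ C) ⟨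
  ∣ preimage (σ ⟨$⟩ʳ_) R ∣ + ∣ preimage (τ ⟨$⟩ʳ_) C ∣  ≤⟨ nz _ _ preimageZero ⟩
  a                                                  ≡⟨ ↔⇒≡ σ ⟩
  n                                                  ∎
  where
  open ≤-Reasoning
  preimageZero : ZeroBlock _ (preimage (σ ⟨$⟩ʳ_) R) (preimage (τ ⟨$⟩ʳ_) C)
  preimageZero i j i∈ j∈ = z _ _ (∈-preimage⁻ i∈) (∈-preimage⁻ j∈)

noLargeZeroBlock-permute : ∀ {a n} {X : Matrix n n} (σ τ : Permutation a n) →
  NoLargeZeroBlock X → NoLargeZeroBlock (λ i j → X (σ ⟨$⟩ʳ i) (τ ⟨$⟩ʳ j))
noLargeZeroBlock-permute {X = X} σ τ nz = noLargeZeroBlock-unpermute (flip σ) (flip τ) λ R C z →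
  nz R C λ i j i∈R j∈C → trans (sym (cong₂ X (inverseʳ σ) (inverseʳ τ))) (z i j i∈R j∈C)

diagonalBlocks⇒noLargeZeroBlock : ∀ {r m} {Y : Matrix (r + m) (r + m)} →
  NoLargeZeroBlock (λ i j → Y (i ↑ˡ m) (j ↑ˡ m)) → NoLargeZeroBlock (λ i j → Y (r ↑ʳ i) (r ↑ʳ j)) →
  NoLargeZeroBlock Y
diagonalBlocks⇒noLargeZeroBlock {r} {m} nz₁ nz₂ R C z with Vec.splitAt r R | Vec.splitAt r C
... | R₁ , R₂ , refl | C₁ , C₂ , refl = begin
  ∣ R₁ ++ R₂ ∣ + ∣ C₁ ++ C₂ ∣            ≡⟨ cong₂ _+_ (∣p++q∣≡∣p∣+∣q∣ R₁ R₂) (∣p++q∣≡∣p∣+∣q∣ C₁ C₂) ⟩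
  (∣ R₁ ∣ + ∣ R₂ ∣) + (∣ C₁ ∣ + ∣ C₂ ∣)  ≡⟨ interchange (∣ R₁ ∣) (∣ R₂ ∣) (∣ C₁ ∣) (∣ C₂ ∣) ⟩
  (∣ R₁ ∣ + ∣ C₁ ∣) + (∣ R₂ ∣ + ∣ C₂ ∣)  ≤⟨ +-mono-≤ (nz₁ R₁ C₁ λ i j i∈ j∈ → z _ _ (∈-++⁺ˡ i∈) (∈-++⁺ˡ j∈))
                                                   (nz₂ R₂ C₂ λ i j i∈ j∈ → z _ _ (∈-++⁺ʳ R₁ i∈) (∈-++⁺ʳ C₁ j∈)) ⟩
  r + m                                  ∎
  where open ≤-Reasoning

module _ {r m} {Y : Matrix (r + m) (r + m)}
         (lowerLeft : ∀ i j → Y (r ↑ʳ i) (j ↑ˡ m) ≡ false) (nz : NoLargeZeroBlock Y) where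

  noLargeZeroBlock-upperLeft : NoLargeZeroBlock (λ i j → Y (i ↑ˡ m) (j ↑ˡ m))
  noLargeZeroBlock-upperLeft S T z = +-cancelʳ-≤ m (∣ S ∣ + ∣ T ∣) r (begin
    (∣ S ∣ + ∣ T ∣) + m                      ≡⟨ cong (∣ S ∣ + ∣ T ∣ +_) (+-identityʳ m) ⟨
    (∣ S ∣ + ∣ T ∣) + (m + 0)                ≡⟨ interchange (∣ S ∣) m (∣ T ∣) 0 ⟨
    (∣ S ∣ + m) + (∣ T ∣ + 0)                ≡⟨ cong₂ _+_ (cong (∣ S ∣ +_) (∣⊤∣≡n m))
                                                         (cong (∣ T ∣ +_) (∣⊥∣≡0 m)) ⟨
    (∣ S ∣ + ∣ ⊤ {m} ∣) + (∣ T ∣ + ∣ ⊥ {m} ∣)  ≡⟨ cong₂ _+_ (∣p++q∣≡∣p∣+∣q∣ S ⊤) (∣p++q∣≡∣p∣+∣q∣ T ⊥) ⟨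
    ∣ S ++ ⊤ {m} ∣ + ∣ T ++ ⊥ {m} ∣          ≤⟨ nz _ _ (zeroBlock-++ z zeroBlock-⊥ʳ (λ i j _ _ → lowerLeft i j)
                                                                   zeroBlock-⊥ʳ) ⟩
    r + m                                    ∎)
    where open ≤-Reasoning

  noLargeZeroBlock-lowerRight : NoLargeZeroBlock (λ i j → Y (r ↑ʳ i) (r ↑ʳ j))
  noLargeZeroBlock-lowerRight S T z = +-cancelˡ-≤ r (∣ S ∣ + ∣ T ∣) m (begin
    r + (∣ S ∣ + ∣ T ∣)                      ≡⟨ interchange 0 (∣ S ∣) r (∣ T ∣) ⟨
    (0 + ∣ S ∣) + (r + ∣ T ∣)                ≡⟨ cong₂ _+_ (cong (_+ ∣ S ∣) (∣⊥∣≡0 r))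
                                                         (cong (_+ ∣ T ∣) (∣⊤∣≡n r)) ⟨
    (∣ ⊥ {r} ∣ + ∣ S ∣) + (∣ ⊤ {r} ∣ + ∣ T ∣)  ≡⟨ cong₂ _+_ (∣p++q∣≡∣p∣+∣q∣ (⊥ {r}) S)
                                                         (∣p++q∣≡∣p∣+∣q∣ (⊤ {r}) T) ⟨
    ∣ ⊥ {r} ++ S ∣ + ∣ ⊤ {r} ++ T ∣          ≤⟨ nz (⊥ ++ S) (⊤ ++ T)
                                                   (zeroBlock-++ zeroBlock-⊥ˡ zeroBlock-⊥ˡ
                                                                 (λ i j _ _ → lowerLeft i j) z) ⟩
    r + m                                    ∎)
    where open ≤-Reasoning

-- Partly and fully indecomposable matrices

largeZeroBlock⇒partlyDecomposable : ∀ {n} {X : Matrix n n} {R C} →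
  ZeroBlock X R C → n < ∣ R ∣ + ∣ C ∣ → PartlyDecomposable X
largeZeroBlock⇒partlyDecomposable {zero} {R = []} {[]} _ ()
largeZeroBlock⇒partlyDecomposable {suc zero} {R = R} {C} z 1<∣R∣+∣C∣
  with 1≤∣p∣⇒nonempty R (n<m+o∧o≤n⇒1≤m (∣p∣≤n C) 1<∣R∣+∣C∣)
     | 1≤∣p∣⇒nonempty C (n<m+o∧m≤n⇒1≤o (∣p∣≤n R) 1<∣R∣+∣C∣)
... | zero , 0∈R | zero , 0∈C = z zero zero 0∈R 0∈C
largeZeroBlock⇒partlyDecomposable {suc (suc n)} {R = R} {C} z n+2<∣R∣+∣C∣
  with splitSize (s≤s (s≤s z≤n)) (∣p∣≤n R) (∣p∣≤n C) n+2<∣R∣+∣C∣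
... | k , 1≤k , k≤n+1 , k≤∣R∣ , n+2∸k≤∣C∣ with ⊆-ofSize R k≤∣R∣ | ⊆-ofSize C n+2∸k≤∣C∣
... | R′ , R′⊆R , ∣R′∣≡k | C′ , C′⊆C , ∣C′∣≡n+2∸k =
  k , 1≤k , k≤n+1 , R′ , C′ , ∣R′∣≡k , ∣C′∣≡n+2∸k , zeroBlock-⊆ z R′⊆R C′⊆C

fullyIndecomposable⇒noLargeZeroBlock : ∀ {n} {X : Matrix n n} →
  FullyIndecomposable X → NoLargeZeroBlock X
fullyIndecomposable⇒noLargeZeroBlock {n} (_ , ¬pd) R C z = decidable-stable (∣ R ∣ + ∣ C ∣ ≤? n)
  λ ∣R∣+∣C∣≰n → ¬pd (largeZeroBlock⇒partlyDecomposable z (≰⇒> ∣R∣+∣C∣≰n))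

SplittingZeroBlock : ∀ {n} → Matrix n n → Subset n → Subset n → Set
SplittingZeroBlock {n} X R C = ZeroBlock X R C × 1 ≤ ∣ R ∣ × 1 ≤ ∣ C ∣ × ∣ R ∣ + ∣ C ∣ ≡ n

splittingZeroBlock? : ∀ {n} (X : Matrix n n) → Dec (∃₂ (SplittingZeroBlock X))
splittingZeroBlock? {n} X = anySubset? λ R → anySubset? λ C →
  zeroBlock? X R C ×-dec (1 ≤? ∣ R ∣) ×-dec (1 ≤? ∣ C ∣) ×-dec (∣ R ∣ + ∣ C ∣ ≟ℕ n)

partlyDecomposable⇒splittingZeroBlock : ∀ {n} {X : Matrix (2 + n) (2 + n)} →
  PartlyDecomposable X → ∃₂ (SplittingZeroBlock X)
partlyDecomposable⇒splittingZeroBlock (k , 1≤k , k≤n+1 , R , C , refl , ∣C∣≡n+2∸k , z) =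
  R , C , z , 1≤k , subst (1 ≤_) (sym ∣C∣≡n+2∸k) (m<n⇒0<n∸m (s≤s k≤n+1)) ,
  trans (cong (k +_) ∣C∣≡n+2∸k) (m+[n∸m]≡n (m≤n⇒m≤1+n k≤n+1))

noLargeZeroBlock⇒fullyIndecomposable : ∀ {n} {X : Matrix n n} → 1 ≤ n → NoLargeZeroBlock X →
  ¬ ∃₂ (SplittingZeroBlock X) → FullyIndecomposable X
noLargeZeroBlock⇒fullyIndecomposable {suc zero} 1≤n nz _ =
  1≤n , λ X₀₀≡false → <-irrefl refl (nz (inside ∷ []) (inside ∷ []) λ { zero zero _ _ → X₀₀≡false })
noLargeZeroBlock⇒fullyIndecomposable {suc (suc n)} 1≤n _ ¬split =
  1≤n , λ pd → ¬split (partlyDecomposable⇒splittingZeroBlock pd)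

partlyDecomposable-cong : ∀ {r} {Y Y′ : Matrix r r} → (∀ i j → Y i j ≡ Y′ i j) →
  PartlyDecomposable Y → PartlyDecomposable Y′
partlyDecomposable-cong {suc zero} Y≗Y′ Y₀₀≡false = trans (sym (Y≗Y′ zero zero)) Y₀₀≡false
partlyDecomposable-cong {suc (suc r)} Y≗Y′ (k , 1≤k , k≤r+1 , R , C , ∣R∣≡k , ∣C∣≡r+2∸k , z) =
  k , 1≤k , k≤r+1 , R , C , ∣R∣≡k , ∣C∣≡r+2∸k , λ i j i∈R j∈C → trans (sym (Y≗Y′ i j)) (z i j i∈R j∈C)

fullyIndecomposable-cong : ∀ {r} {Y Y′ : Matrix r r} → (∀ i j → Y i j ≡ Y′ i j) →
  FullyIndecomposable Y → FullyIndecomposable Y′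
fullyIndecomposable-cong Y≗Y′ (1≤r , ¬pd) =
  1≤r , λ pd → ¬pd (partlyDecomposable-cong (λ i j → sym (Y≗Y′ i j)) pd)

-- Block triangular forms

blockTriangular-cong : ∀ {n k} {Y Y′ : Matrix n n} → (∀ i j → Y i j ≡ Y′ i j) →
  BlockTriangular n Y k → BlockTriangular n Y′ k
blockTriangular-cong Y≗Y′ (single _ fi) = single _ (fullyIndecomposable-cong Y≗Y′ fi)
blockTriangular-cong {Y′ = Y′} Y≗Y′ (cons {r} {m} _ fi lowerLeft bt) =
  cons Y′ (fullyIndecomposable-cong (λ i j → Y≗Y′ (i ↑ˡ m) (j ↑ˡ m)) fi)
          (λ i j → trans (sym (Y≗Y′ (r ↑ʳ i) (j ↑ˡ m))) (lowerLeft i j))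
          (blockTriangular-cong (λ i j → Y≗Y′ (r ↑ʳ i) (r ↑ʳ j)) bt)

blockTriangular-cast : ∀ {a b k} (a≡b : a ≡ b) (Y : Matrix b b) →
  BlockTriangular a (λ i j → Y (cast a≡b i) (cast a≡b j)) k → BlockTriangular b Y k
blockTriangular-cast refl Y = blockTriangular-cong λ i j → cong₂ Y (cast-is-id refl i) (cast-is-id refl j)

blockTriangular-++ : ∀ {r m k₁ k₂} (Y : Matrix (r + m) (r + m)) →
  BlockTriangular r (λ i j → Y (i ↑ˡ m) (j ↑ˡ m)) k₁ →
  (∀ i j → Y (r ↑ʳ i) (j ↑ˡ m) ≡ false) →
  BlockTriangular m (λ i j → Y (r ↑ʳ i) (r ↑ʳ j)) k₂ →
  BlockTriangular (r + m) Y (k₁ + k₂)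
blockTriangular-++ Y (single _ fi) lowerLeft bt₂ = cons Y fi lowerLeft bt₂
blockTriangular-++ {m = m} {k₂ = k₂} Y (cons {r₁} {m₁} {k₁} _ fi₁ lowerLeft₁ bt₁) lowerLeft bt₂ =
  blockTriangular-cast (sym (+-assoc r₁ m₁ m)) Y (cons Y′ fi′ lowerLeft′ rest)
  where
  Y′ : Matrix (r₁ + (m₁ + m)) (r₁ + (m₁ + m))
  Y′ i j = Y (reassoc r₁ m₁ m i) (reassoc r₁ m₁ m j)
  fi′ : FullyIndecomposable (λ i j → Y′ (i ↑ˡ (m₁ + m)) (j ↑ˡ (m₁ + m)))
  fi′ = fullyIndecomposable-cong (λ i j → sym (cong₂ Y (reassoc-↑ˡ i) (reassoc-↑ˡ j))) fi₁
  lowerLeft′ : ∀ i j → Y′ (r₁ ↑ʳ i) (j ↑ˡ (m₁ + m)) ≡ false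
  lowerLeft′ = ↑-elim {P = λ i → ∀ j → Y′ (r₁ ↑ʳ i) (j ↑ˡ (m₁ + m)) ≡ false}
    (λ i j → trans (cong₂ Y (reassoc-↑ʳ-↑ˡ r₁ i) (reassoc-↑ˡ j)) (lowerLeft₁ i j))
    (λ i j → trans (cong₂ Y (reassoc-↑ʳ-↑ʳ r₁ i) (reassoc-↑ˡ j)) (lowerLeft i (j ↑ˡ m₁)))
  rest : BlockTriangular (m₁ + m) (λ i j → Y′ (r₁ ↑ʳ i) (r₁ ↑ʳ j)) (k₁ + k₂)
  rest = blockTriangular-++ (λ i j → Y′ (r₁ ↑ʳ i) (r₁ ↑ʳ j))
    (blockTriangular-cong (λ i j → sym (cong₂ Y (reassoc-↑ʳ-↑ˡ r₁ i) (reassoc-↑ʳ-↑ˡ r₁ j))) bt₁)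
    (λ i j → trans (cong₂ Y (reassoc-↑ʳ-↑ʳ r₁ i) (reassoc-↑ʳ-↑ˡ r₁ j)) (lowerLeft i (r₁ ↑ʳ j)))
    (blockTriangular-cong (λ i j → sym (cong₂ Y (reassoc-↑ʳ-↑ʳ r₁ i) (reassoc-↑ʳ-↑ʳ r₁ j))) bt₂)

blockTriangular⇒1≤k : ∀ {n k} {Y : Matrix n n} → BlockTriangular n Y k → 1 ≤ k
blockTriangular⇒1≤k (single _ _) = ≤-refl
blockTriangular⇒1≤k (cons _ _ _ _) = s≤s z≤n

blockTriangular⇒noLargeZeroBlock : ∀ {n k} {Y : Matrix n n} → BlockTriangular n Y k → NoLargeZeroBlock Y
blockTriangular⇒noLargeZeroBlock (single _ fi) = fullyIndecomposable⇒noLargeZeroBlock fi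
blockTriangular⇒noLargeZeroBlock (cons _ fi _ bt) =
  diagonalBlocks⇒noLargeZeroBlock (fullyIndecomposable⇒noLargeZeroBlock fi)
                                  (blockTriangular⇒noLargeZeroBlock bt)

BlockTriangularizable : ∀ {n} → Matrix n n → Set
BlockTriangularizable {n} X =
  Σ (Permutation′ n) λ σ → Σ (Permutation′ n) λ τ → ∃[ k ] BlockTriangular n (permute σ τ X) k

blockTriangularizable-unpermute : ∀ {a n} {X : Matrix n n} (ρ κ : Permutation a n) →
  BlockTriangularizable (λ i j → X (ρ ⟨$⟩ʳ i) (κ ⟨$⟩ʳ j)) → BlockTriangularizable X
blockTriangularizable-unpermute ρ κ with ↔⇒≡ ρ
... | refl = λ (σ , τ , k , bt) → σ ∘ₚ ρ , τ ∘ₚ κ , k , bt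

blockTriangularizable-++ : ∀ {r m} (Y : Matrix (r + m) (r + m)) →
  BlockTriangularizable (λ i j → Y (i ↑ˡ m) (j ↑ˡ m)) →
  (∀ i j → Y (r ↑ʳ i) (j ↑ˡ m) ≡ false) →
  BlockTriangularizable (λ i j → Y (r ↑ʳ i) (r ↑ʳ j)) →
  BlockTriangularizable Y
blockTriangularizable-++ Y (σ₁ , τ₁ , k₁ , bt₁) lowerLeft (σ₂ , τ₂ , k₂ , bt₂) =
  σ₁ ⊕ σ₂ , τ₁ ⊕ τ₂ , k₁ + k₂ , blockTriangular-++ _
    (blockTriangular-cong (λ i j → sym (cong₂ Y (⊕-↑ˡ σ₁ σ₂ i) (⊕-↑ˡ τ₁ τ₂ j))) bt₁)
    (λ i j → trans (cong₂ Y (⊕-↑ʳ σ₁ σ₂ i) (⊕-↑ˡ τ₁ τ₂ j)) (lowerLeft _ _))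
    (blockTriangular-cong (λ i j → sym (cong₂ Y (⊕-↑ʳ σ₁ σ₂ i) (⊕-↑ʳ τ₁ τ₂ j))) bt₂)

splittingZeroBlock⇒blockUpperTriangular : ∀ {n} {X : Matrix n n} {R C} → SplittingZeroBlock X R C →
  Σ (Permutation (∣ C ∣ + ∣ R ∣) n) λ ρ → Σ (Permutation (∣ C ∣ + ∣ R ∣) n) λ κ →
    ∀ i j → X (ρ ⟨$⟩ʳ (∣ C ∣ ↑ʳ i)) (κ ⟨$⟩ʳ (j ↑ˡ ∣ R ∣)) ≡ false
splittingZeroBlock⇒blockUpperTriangular {n} {R = R} {C} (z , _ , _ , ∣R∣+∣C∣≡n)
  with sortingPermutation′ (∁ R) ∣∁R∣≡∣C∣ ∣∁∁R∣≡∣R∣ | sortingPermutation′ C refl ∣∁C∣≡∣R∣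
  where
  ∣∁R∣≡∣C∣ : ∣ ∁ R ∣ ≡ ∣ C ∣
  ∣∁R∣≡∣C∣ = trans (∣∁p∣≡n∸∣p∣ R) (trans (cong (_∸ ∣ R ∣) (sym ∣R∣+∣C∣≡n)) (m+n∸m≡n ∣ R ∣ ∣ C ∣))
  ∣∁∁R∣≡∣R∣ : ∣ ∁ (∁ R) ∣ ≡ ∣ R ∣
  ∣∁∁R∣≡∣R∣ = trans (∣∁p∣≡n∸∣p∣ (∁ R)) (trans (cong₂ _∸_ (sym ∣R∣+∣C∣≡n) ∣∁R∣≡∣C∣) (m+n∸n≡m ∣ R ∣ ∣ C ∣))
  ∣∁C∣≡∣R∣ : ∣ ∁ C ∣ ≡ ∣ R ∣
  ∣∁C∣≡∣R∣ = trans (∣∁p∣≡n∸∣p∣ C) (trans (cong (_∸ ∣ C ∣) (sym ∣R∣+∣C∣≡n)) (m+n∸n≡m ∣ R ∣ ∣ C ∣))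
... | ρ , _ , ρ-∉∁R | κ , κ-∈C , _ = ρ , κ , λ i j → z _ _ (x∉∁p⇒x∈p (ρ-∉∁R i)) (κ-∈C j)

noLargeZeroBlock⇒blockTriangularizable : ∀ {n} → Acc _<_ n → (X : Matrix n n) → 1 ≤ n →
  NoLargeZeroBlock X → BlockTriangularizable X
noLargeZeroBlock⇒blockTriangularizable (acc smaller) X 1≤n nz with splittingZeroBlock? X
... | no ¬split = id , id , 1 , single X (noLargeZeroBlock⇒fullyIndecomposable 1≤n nz ¬split)
... | yes (R , C , split@(_ , 1≤∣R∣ , 1≤∣C∣ , ∣R∣+∣C∣≡n))
  with splittingZeroBlock⇒blockUpperTriangular split
... | ρ , κ , lowerLeft = blockTriangularizable-unpermute {X = X} ρ κ (blockTriangularizable-++ Y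
        (noLargeZeroBlock⇒blockTriangularizable (smaller ∣C∣<n) _ 1≤∣C∣
          (noLargeZeroBlock-upperLeft lowerLeft nzY))
        lowerLeft
        (noLargeZeroBlock⇒blockTriangularizable (smaller ∣R∣<n) _ 1≤∣R∣
          (noLargeZeroBlock-lowerRight lowerLeft nzY)))
  where
  Y : Matrix (∣ C ∣ + ∣ R ∣) (∣ C ∣ + ∣ R ∣)
  Y i j = X (ρ ⟨$⟩ʳ i) (κ ⟨$⟩ʳ j)
  nzY : NoLargeZeroBlock Y
  nzY = noLargeZeroBlock-permute ρ κ nz
  ∣C∣<n : ∣ C ∣ < _
  ∣C∣<n = subst (∣ C ∣ <_) ∣R∣+∣C∣≡n (m<n+m ∣ C ∣ 1≤∣R∣)
  ∣R∣<n : ∣ R ∣ < _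
  ∣R∣<n = subst (∣ R ∣ <_) ∣R∣+∣C∣≡n (m<m+n ∣ R ∣ 1≤∣C∣)

-- The bipartite graph of a matrix

module _ {n} (X : Matrix n n) where

  bipartiteGraph-↑ˡ-↑ʳ : ∀ i j → bipartiteGraph n X (i ↑ˡ n) (n ↑ʳ j) ≡ X i j
  bipartiteGraph-↑ˡ-↑ʳ i j rewrite splitAt-↑ˡ n i n | splitAt-↑ʳ n n j = refl

  bipartiteGraph-↑ʳ-↑ˡ : ∀ i j → bipartiteGraph n X (n ↑ʳ j) (i ↑ˡ n) ≡ X i j
  bipartiteGraph-↑ʳ-↑ˡ i j rewrite splitAt-↑ˡ n i n | splitAt-↑ʳ n n j = refl

  bipartiteGraph-↑ˡ-↑ˡ : ∀ i i′ → bipartiteGraph n X (i ↑ˡ n) (i′ ↑ˡ n) ≡ false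
  bipartiteGraph-↑ˡ-↑ˡ i i′ rewrite splitAt-↑ˡ n i n | splitAt-↑ˡ n i′ n = refl

  bipartiteGraph-↑ʳ-↑ʳ : ∀ j j′ → bipartiteGraph n X (n ↑ʳ j) (n ↑ʳ j′) ≡ false
  bipartiteGraph-↑ʳ-↑ʳ j j′ rewrite splitAt-↑ʳ n n j | splitAt-↑ʳ n n j′ = refl

  stable⇒zeroBlock : ∀ {R C} → Stable (bipartiteGraph n X) (R ++ C) → ZeroBlock X R C
  stable⇒zeroBlock {R} st i j i∈R j∈C =
    trans (sym (bipartiteGraph-↑ˡ-↑ʳ i j)) (st _ _ (∈-++⁺ˡ i∈R) (∈-++⁺ʳ R j∈C))

  zeroBlock⇒stable : ∀ {R C} → ZeroBlock X R C → Stable (bipartiteGraph n X) (R ++ C)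
  zeroBlock⇒stable {R} {C} z =
    ↑-elim {P = λ u → ∀ v → u ∈ R ++ C → v ∈ R ++ C → bipartiteGraph n X u v ≡ false}
      (λ i → ↑-elim (λ i′ _ _ → bipartiteGraph-↑ˡ-↑ˡ i i′)
                    (λ j i∈ j∈ → trans (bipartiteGraph-↑ˡ-↑ʳ i j) (z i j (∈-++⁻ˡ R i i∈) (∈-++⁻ʳ R j∈))))
      (λ j → ↑-elim (λ i j∈ i∈ → trans (bipartiteGraph-↑ʳ-↑ˡ i j) (z i j (∈-++⁻ˡ R i i∈) (∈-++⁻ʳ R j∈)))
                    (λ j′ _ _ → bipartiteGraph-↑ʳ-↑ʳ j j′))

  zeroBlocksAtMost⇒stableAtMost : ∀ {a} → ZeroBlocksAtMost X a →
    ∀ S → Stable (bipartiteGraph n X) S → ∣ S ∣ ≤ a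
  zeroBlocksAtMost⇒stableAtMost {a} atMost S st with Vec.splitAt n S
  ... | R , C , refl = subst (_≤ a) (sym (∣p++q∣≡∣p∣+∣q∣ R C)) (atMost R C (stable⇒zeroBlock st))

  isMaxZeroBlockSize⇒isAlpha : ∀ {α} → IsMaxZeroBlockSize X α → IsAlpha (bipartiteGraph n X) α
  isMaxZeroBlockSize⇒isAlpha ((R , C , z , size) , atMost) =
    (R ++ C , zeroBlock⇒stable z , trans (∣p++q∣≡∣p∣+∣q∣ R C) size) ,
    zeroBlocksAtMost⇒stableAtMost atMost

  noLargeZeroBlock⇒alphaPlusStable : NoLargeZeroBlock X → AlphaPlusStable (bipartiteGraph n X)
  noLargeZeroBlock⇒alphaPlusStable nz = disjointMaximumStableSets⇒alphaPlusStable
    (zeroBlock⇒stable {⊤} {⊥} zeroBlock-⊥ʳ) (zeroBlock⇒stable {⊥} {⊤} zeroBlock-⊥ˡ)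
    disjoint (trans ∣B∣≡n (sym ∣A∣≡n))
    (λ U st → subst (∣ U ∣ ≤_) (sym ∣A∣≡n) (zeroBlocksAtMost⇒stableAtMost nz U st))
    where
    A B : Subset (n + n)
    A = ⊤ {n} ++ ⊥ {n}
    B = ⊥ {n} ++ ⊤ {n}
    ∣A∣≡n : ∣ A ∣ ≡ n
    ∣A∣≡n = trans (∣p++q∣≡∣p∣+∣q∣ (⊤ {n}) ⊥) (trans (cong₂ _+_ (∣⊤∣≡n n) (∣⊥∣≡0 n)) (+-identityʳ n))
    ∣B∣≡n : ∣ B ∣ ≡ n
    ∣B∣≡n = trans (∣p++q∣≡∣p∣+∣q∣ (⊥ {n}) ⊤) (cong₂ _+_ (∣⊥∣≡0 n) (∣⊤∣≡n n))
    disjoint : ∀ {u} → u ∈ A → u ∉ B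
    disjoint {u} = ↑-elim {n} {n} {P = λ u → u ∈ A → u ∉ B}
      (λ i _ i∈B → ∉⊥ (∈-++⁻ˡ (⊥ {n}) i i∈B)) (λ j j∈A _ → ∉⊥ (∈-++⁻ʳ (⊤ {n}) j∈A)) u

  largeMaxZeroBlock⇒¬alphaPlusStable : ∀ {α} → IsMaxZeroBlockSize X α → n < α →
    ¬ AlphaPlusStable (bipartiteGraph n X)
  largeMaxZeroBlock⇒¬alphaPlusStable {α} isMax n<α with coreRow X isMax n<α | coreColumn X isMax n<α
  ... | a , a∈ | b , b∈ =
    commonVertices⇒¬alphaPlusStable (isMaxZeroBlockSize⇒isAlpha isMax) (↑ˡ≢↑ʳ a b) common
    where
    common : ∀ S → Stable (bipartiteGraph n X) S → ∣ S ∣ ≡ α → a ↑ˡ n ∈ S × n ↑ʳ b ∈ S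
    common S st ∣S∣≡α with Vec.splitAt n S
    ... | R , C , refl = ∈-++⁺ˡ (a∈ R C z size) , ∈-++⁺ʳ R (b∈ R C z size)
      where
      z : ZeroBlock X R C
      z = stable⇒zeroBlock st
      size : ∣ R ∣ + ∣ C ∣ ≡ α
      size = trans (sym (∣p++q∣≡∣p∣+∣q∣ R C)) ∣S∣≡α

  alphaPlusStable⇒noLargeZeroBlock : AlphaPlusStable (bipartiteGraph n X) → NoLargeZeroBlock X
  alphaPlusStable⇒noLargeZeroBlock aps R C z with maxZeroBlockSize X
  ... | α , isMax = decidable-stable (∣ R ∣ + ∣ C ∣ ≤? n) λ ∣R∣+∣C∣≰n →
    largeMaxZeroBlock⇒¬alphaPlusStable isMax (<-≤-trans (≰⇒> ∣R∣+∣C∣≰n) (proj₂ isMax R C z)) aps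

theorem6 : (n : ℕ) → 1 ≤ n → (X : Matrix n n) →
    AlphaPlusStable (bipartiteGraph n X) ⇔
    (Σ (Permutation′ n) λ σ → Σ (Permutation′ n) λ τ → Σ ℕ λ k →
    1 ≤ k × BlockTriangular n (permute σ τ X) k)
theorem6 n 1≤n X = mk⇔
  (λ aps → withBlockCount (noLargeZeroBlock⇒blockTriangularizable (<-wellFounded n) X 1≤n
                              (alphaPlusStable⇒noLargeZeroBlock X aps)))
  (λ (σ , τ , _ , _ , bt) → noLargeZeroBlock⇒alphaPlusStable X
     (noLargeZeroBlock-unpermute σ τ (blockTriangular⇒noLargeZeroBlock bt)))
  where
  withBlockCount : BlockTriangularizable X →
    Σ (Permutation′ n) λ σ → Σ (Permutation′ n) λ τ → Σ ℕ λ k → 1 ≤ k × BlockTriangular n (permute σ τ X) k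
  withBlockCount (σ , τ , k , bt) = σ , τ , k , blockTriangular⇒1≤k bt , bt
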